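{- For every integer $k\ge1$, $T(2,2k-1;k)>T(2,2k-1;k-1)$.
   Context: For integers $n\ge0$ and $k\ge0$, $T(2,n;k)$ denotes the number of ways to select a set of $k$ squares from a $2\times n$ rectangular grid of unit squares ($2$ rows, $n$ columns) such that no two selected squares are horizontally or vertically adjacent (share an edge). -}

module Defs where

open import Data.Nat using (ℕ; zero; suc; _+_; _*_)
open import Data.Bool using (Bool; true; false; _∧_; not; if_then_else_)
open import Data.List using (List; []; _∷_; map; concatMap; filter; length; cartesianProductWith)
open import Data.Vec using (Vec; []; _∷_; zipWith; toList; foldr)
open import Data.Fin using (Fin)
open import Relation.Nullary.Decidable using (Dec; yes; no)
open import Relation.Binary.PropositionalEquality using (_≡_)
import Data.Nat as ℕ

-- A selection of squares in a 2×n grid: a 2-row vector of rows, each row a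
-- Vec Bool n; entry true = square selected.
Grid : ℕ → Set
Grid n = Vec (Vec Bool n) 2

allRows : (n : ℕ) → List (Vec Bool n)
allRows zero = [] ∷ []
allRows (suc n) = concatMap (λ r → (false ∷ r) ∷ (true ∷ r) ∷ []) (allRows n)

allGrids : (n : ℕ) → List (Grid n)
allGrids n = cartesianProductWith (λ r s → r ∷ s ∷ []) (allRows n) (allRows n)

countRow : ∀ {n} → Vec Bool n → ℕ
countRow = foldr _ (λ b acc → (if b then 1 else 0) + acc) 0

size : ∀ {n} → Grid n → ℕ
size (r ∷ s ∷ []) = countRow r + countRow s

rowOK : ∀ {n} → Vec Bool n → Bool
rowOK [] = true
rowOK (a ∷ []) = true
rowOK (a ∷ b ∷ r) = not (a ∧ b) ∧ rowOK (b ∷ r)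

colsOK : ∀ {n} → Vec Bool n → Vec Bool n → Bool
colsOK [] [] = true
colsOK (a ∷ r) (b ∷ s) = not (a ∧ b) ∧ colsOK r s

independent : ∀ {n} → Grid n → Bool
independent (r ∷ s ∷ []) = rowOK r ∧ rowOK s ∧ colsOK r s

-- T(2,n;k): number of k-subsets of squares of the 2×n grid with no two
-- edge-adjacent squares.
T2 : ℕ → ℕ → ℕ
T2 n k = length (filter (λ g → (independent g Data.Bool.∧ (size g ℕ.≡ᵇ k)) Data.Bool.≟ true) (allGrids n))

module Submission where

-- Independent sets in the 2×n grid are counted by scanning it column by
-- column.  Let A n k be the number of independent k-sets of the 2×n grid and
-- B n k the number of those avoiding the top square of the first column.
-- Splitting off the first column gives the transfer recursions
--   A (n+1) k = A n k + 2·B n (k-1),      B (n+1) k = A n k + B n (k-1).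
-- These imply that B (p+q) p obeys the Delannoy recurrence, so B (p+q) p is
-- the Delannoy number D p q, and therefore
--   T(2,p+q;p) = D(p,q+1) - D(p-1,q+1).
-- For n = 2k-1 both counts of the theorem share the summand D(k-1,k) and
-- differ in D(k-2,k) versus D(k-1,k-1); the theorem thus reduces to the fact
-- that Delannoy numbers increase towards the middle of an antidiagonal.

open import Defs
open import Data.Nat using (ℕ; zero; suc; _+_; _*_; _∸_; _<_; _≤_; _≥_; z≤n; s≤s)
open import Data.Nat.Properties
open import Data.Bool using (Bool; true; false; _∧_; not; if_then_else_)
open import Data.Bool.Properties using (∧-commutativeMonoid)
open import Data.List using (List; []; _∷_; _++_; map; concatMap; filter; length; cartesianProductWith)
open import Data.Vec using (Vec; []; _∷_)
open import Data.Sum using (inj₁; inj₂)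
open import Algebra.Bundles using (CommutativeMonoid)
open import Relation.Binary.PropositionalEquality
open import Data.Nat.Tactic.RingSolver using (solve-∀)
import Data.Nat as ℕ
import Data.Bool
import Algebra.Properties.CommutativeSemigroup as CommSemigroupProperties

open CommSemigroupProperties +-commutativeSemigroup
  using () renaming (interchange to +-interchange)
open CommSemigroupProperties (CommutativeMonoid.commutativeSemigroup ∧-commutativeMonoid)
  using () renaming (interchange to ∧-interchange)
open ≡-Reasoning

∑ : {A : Set} → List A → (A → ℕ) → ℕ
∑ [] h = 0
∑ (x ∷ xs) h = h x + ∑ xs h

syntax ∑ xs (λ x → e) = ∑[ x ∈ xs ] e

∑-cong : {A : Set} (xs : List A) {h g : A → ℕ} → (∀ x → h x ≡ g x) → ∑ xs h ≡ ∑ xs g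
∑-cong [] eq = refl
∑-cong (x ∷ xs) eq = cong₂ _+_ (eq x) (∑-cong xs eq)

∑-zero : {A : Set} (xs : List A) → ∑[ x ∈ xs ] 0 ≡ 0
∑-zero [] = refl
∑-zero (x ∷ xs) = ∑-zero xs

∑-+ : {A : Set} (xs : List A) (h g : A → ℕ) → ∑[ x ∈ xs ] (h x + g x) ≡ ∑ xs h + ∑ xs g
∑-+ [] h g = refl
∑-+ (x ∷ xs) h g = begin
  (h x + g x) + ∑[ x ∈ xs ] (h x + g x) ≡⟨ cong (h x + g x +_) (∑-+ xs h g) ⟩
  (h x + g x) + (∑ xs h + ∑ xs g)       ≡⟨ +-interchange (h x) (g x) (∑ xs h) (∑ xs g) ⟩
  (h x + ∑ xs h) + (g x + ∑ xs g)       ∎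

∑-++ : {A : Set} (xs ys : List A) (h : A → ℕ) → ∑ (xs ++ ys) h ≡ ∑ xs h + ∑ ys h
∑-++ [] ys h = refl
∑-++ (x ∷ xs) ys h = trans (cong (h x +_) (∑-++ xs ys h)) (sym (+-assoc (h x) _ _))

∑-map : {A B : Set} (f : A → B) (xs : List A) (h : B → ℕ) → ∑ (map f xs) h ≡ ∑[ x ∈ xs ] h (f x)
∑-map f [] h = refl
∑-map f (x ∷ xs) h = cong (h (f x) +_) (∑-map f xs h)

∑-concatMap : {A B : Set} (f : A → List B) (xs : List A) (h : B → ℕ) →
              ∑ (concatMap f xs) h ≡ ∑[ x ∈ xs ] ∑ (f x) h
∑-concatMap f [] h = refl
∑-concatMap f (x ∷ xs) h = trans (∑-++ (f x) _ h) (cong (∑ (f x) h +_) (∑-concatMap f xs h))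

∑-cartesian : {A B C : Set} (f : A → B → C) (xs : List A) (ys : List B) (h : C → ℕ) →
              ∑ (cartesianProductWith f xs ys) h ≡ ∑[ x ∈ xs ] ∑[ y ∈ ys ] h (f x y)
∑-cartesian f [] ys h = refl
∑-cartesian f (x ∷ xs) ys h =
  trans (∑-++ (map (f x) ys) _ h) (cong₂ _+_ (∑-map (f x) ys h) (∑-cartesian f xs ys h))

∑-swap : {A B : Set} (xs : List A) (ys : List B) (h : A → B → ℕ) →
         ∑[ x ∈ xs ] ∑[ y ∈ ys ] h x y ≡ ∑[ y ∈ ys ] ∑[ x ∈ xs ] h x y
∑-swap [] ys h = sym (∑-zero ys)
∑-swap (x ∷ xs) ys h = begin
  ∑[ y ∈ ys ] h x y + ∑[ x' ∈ xs ] ∑[ y ∈ ys ] h x' y ≡⟨ cong (∑[ y ∈ ys ] h x y +_) (∑-swap xs ys h) ⟩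
  ∑[ y ∈ ys ] h x y + ∑[ y ∈ ys ] ∑[ x' ∈ xs ] h x' y ≡⟨ sym (∑-+ ys (h x) _) ⟩
  ∑[ y ∈ ys ] (h x y + ∑[ x' ∈ xs ] h x' y)            ∎

bit : Bool → ℕ
bit b = if b then 1 else 0

bit-∧-false : ∀ b → bit (b ∧ false) ≡ 0
bit-∧-false true = refl
bit-∧-false false = refl

length-filter : {A : Set} (t : A → Bool) (xs : List A) →
                length (filter (λ x → t x Data.Bool.≟ true) xs) ≡ ∑[ x ∈ xs ] bit (t x)
length-filter t [] = refl
length-filter t (x ∷ xs) with t x
... | true = cong suc (length-filter t xs)
... | false = length-filter t xs

bools : List Bool
bools = false ∷ true ∷ []

∑-allRows-suc : ∀ n (h : Vec Bool (suc n) → ℕ) →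
                ∑ (allRows (suc n)) h ≡ ∑[ r ∈ allRows n ] ∑[ x ∈ bools ] h (x ∷ r)
∑-allRows-suc n h = ∑-concatMap (λ r → map (_∷ r) bools) (allRows n) h

-- rowAfter p r: the row r has no two adjacent selected squares, and its first
-- square is free if the square before it is selected (p = true).
rowAfter : ∀ {n} → Bool → Vec Bool n → Bool
rowAfter p [] = true
rowAfter p (a ∷ r) = not (p ∧ a) ∧ rowAfter a r

rowOK-rowAfter : ∀ {n} (r : Vec Bool n) → rowOK r ≡ rowAfter false r
rowOK-rowAfter [] = refl
rowOK-rowAfter (a ∷ r) = cons a r
  where
  cons : ∀ {n} a (r : Vec Bool n) → rowOK (a ∷ r) ≡ rowAfter a r
  cons a [] = refl
  cons a (b ∷ r) = cong (not (a ∧ b) ∧_) (cons b r)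

columnFits : Bool → Bool → Bool → Bool → Bool
columnFits p q x y = not (p ∧ x) ∧ not (q ∧ y) ∧ not (x ∧ y)

gridAfter : ∀ {n} → Bool → Bool → Vec Bool n → Vec Bool n → Bool
gridAfter p q [] [] = true
gridAfter p q (x ∷ r) (y ∷ s) = columnFits p q x y ∧ gridAfter x y r s

gridAfter-rows : ∀ {n} p q (r s : Vec Bool n) →
                 gridAfter p q r s ≡ rowAfter p r ∧ rowAfter q s ∧ colsOK r s
gridAfter-rows p q [] [] = refl
gridAfter-rows p q (x ∷ r) (y ∷ s) = begin
  (a ∧ b ∧ c) ∧ gridAfter x y r s  ≡⟨ cong ((a ∧ b ∧ c) ∧_) (gridAfter-rows x y r s) ⟩
  (a ∧ b ∧ c) ∧ (u ∧ v ∧ w)        ≡⟨ ∧-interchange a (b ∧ c) u (v ∧ w) ⟩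
  (a ∧ u) ∧ ((b ∧ c) ∧ (v ∧ w))    ≡⟨ cong ((a ∧ u) ∧_) (∧-interchange b c v w) ⟩
  (a ∧ u) ∧ (b ∧ v) ∧ (c ∧ w)      ∎
  where
  a = not (p ∧ x); b = not (q ∧ y); c = not (x ∧ y)
  u = rowAfter x r; v = rowAfter y s; w = colsOK r s

count : ℕ → Bool → Bool → ℕ → ℕ
count n p q k =
  ∑[ r ∈ allRows n ] ∑[ s ∈ allRows n ] bit (gridAfter p q r s ∧ (countRow r + countRow s ℕ.≡ᵇ k))

T2-count : ∀ n k → T2 n k ≡ count n false false k
T2-count n k = begin
  T2 n k
    ≡⟨ length-filter _ (allGrids n) ⟩
  ∑[ g ∈ allGrids n ] bit (independent g ∧ (size g ℕ.≡ᵇ k))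
    ≡⟨ ∑-cartesian _ (allRows n) (allRows n) _ ⟩
  ∑[ r ∈ allRows n ] ∑[ s ∈ allRows n ] bit ((rowOK r ∧ rowOK s ∧ colsOK r s) ∧ (countRow r + countRow s ℕ.≡ᵇ k))
    ≡⟨ ∑-cong (allRows n) (λ r → ∑-cong (allRows n) (λ s →
         cong (λ b → bit (b ∧ (countRow r + countRow s ℕ.≡ᵇ k))) (independent-gridAfter r s))) ⟩
  count n false false k ∎
  where
  independent-gridAfter : ∀ {n} (r s : Vec Bool n) → rowOK r ∧ rowOK s ∧ colsOK r s ≡ gridAfter false false r s
  independent-gridAfter r s = trans (cong₂ (λ a b → a ∧ b ∧ colsOK r s) (rowOK-rowAfter r) (rowOK-rowAfter s))
                                    (sym (gridAfter-rows false false r s))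

-- shift w f k = f (k - w) if w ≤ k and 0 otherwise: the count with w more
-- squares selected.
shift : ℕ → (ℕ → ℕ) → ℕ → ℕ
shift zero f k = f k
shift (suc w) f zero = 0
shift (suc w) f (suc k) = shift w f k

shift-cong : ∀ w {f g : ℕ → ℕ} → (∀ k → f k ≡ g k) → ∀ k → shift w f k ≡ shift w g k
shift-cong zero eq k = eq k
shift-cong (suc w) eq zero = refl
shift-cong (suc w) eq (suc k) = shift-cong w eq k

count-offset : ∀ n p q w k →
  ∑[ r ∈ allRows n ] ∑[ s ∈ allRows n ] bit (gridAfter p q r s ∧ (w + (countRow r + countRow s) ℕ.≡ᵇ k))
  ≡ shift w (count n p q) k
count-offset n p q zero k = refl
count-offset n p q (suc w) (suc k) = count-offset n p q w k
count-offset n p q (suc w) zero = trans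
  (∑-cong (allRows n) (λ r → trans (∑-cong (allRows n) (λ s → bit-∧-false (gridAfter p q r s))) (∑-zero (allRows n))))
  (∑-zero (allRows n))

contribution : ℕ → Bool → Bool → ℕ → Bool → Bool → ℕ
contribution n p q k x y = if columnFits p q x y then shift (bit x + bit y) (count n x y) k else 0

first-column : ∀ n p q k x y →
  ∑[ r ∈ allRows n ] ∑[ s ∈ allRows n ]
    bit (gridAfter p q (x ∷ r) (y ∷ s) ∧ (countRow (x ∷ r) + countRow (y ∷ s) ℕ.≡ᵇ k))
  ≡ contribution n p q k x y
first-column n p q k x y = trans
  (∑-cong (allRows n) (λ r → ∑-cong (allRows n) (λ s →
     cong (λ m → bit ((columnFits p q x y ∧ gridAfter x y r s) ∧ (m ℕ.≡ᵇ k)))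
          (+-interchange (bit x) (countRow r) (bit y) (countRow s)))))
  (fits (columnFits p q x y))
  where
  fits : ∀ c → ∑[ r ∈ allRows n ] ∑[ s ∈ allRows n ]
                 bit ((c ∧ gridAfter x y r s) ∧ (bit x + bit y + (countRow r + countRow s) ℕ.≡ᵇ k))
               ≡ (if c then shift (bit x + bit y) (count n x y) k else 0)
  fits true = count-offset n x y (bit x + bit y) k
  fits false = trans (∑-cong (allRows n) (λ r → ∑-zero (allRows n))) (∑-zero (allRows n))

count-step : ∀ n p q k → count (suc n) p q k ≡ ∑[ x ∈ bools ] ∑[ y ∈ bools ] contribution n p q k x y
count-step n p q k = begin
  count (suc n) p q k
    ≡⟨ ∑-allRows-suc n _ ⟩
  ∑[ r ∈ allRows n ] ∑[ x ∈ bools ] ∑[ s′ ∈ allRows (suc n) ] cell (x ∷ r) s′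
    ≡⟨ ∑-cong (allRows n) (λ r → ∑-cong bools (λ x → ∑-allRows-suc n (cell (x ∷ r)))) ⟩
  ∑[ r ∈ allRows n ] ∑[ x ∈ bools ] ∑[ s ∈ allRows n ] ∑[ y ∈ bools ] cell (x ∷ r) (y ∷ s)
    ≡⟨ ∑-swap (allRows n) bools (λ r x → ∑[ s ∈ allRows n ] ∑[ y ∈ bools ] cell (x ∷ r) (y ∷ s)) ⟩
  ∑[ x ∈ bools ] ∑[ r ∈ allRows n ] ∑[ s ∈ allRows n ] ∑[ y ∈ bools ] cell (x ∷ r) (y ∷ s)
    ≡⟨ ∑-cong bools (λ x → ∑-cong (allRows n) (λ r → ∑-swap (allRows n) bools (λ s y → cell (x ∷ r) (y ∷ s)))) ⟩
  ∑[ x ∈ bools ] ∑[ r ∈ allRows n ] ∑[ y ∈ bools ] ∑[ s ∈ allRows n ] cell (x ∷ r) (y ∷ s)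
    ≡⟨ ∑-cong bools (λ x → ∑-swap (allRows n) bools (λ r y → ∑[ s ∈ allRows n ] cell (x ∷ r) (y ∷ s))) ⟩
  ∑[ x ∈ bools ] ∑[ y ∈ bools ] ∑[ r ∈ allRows n ] ∑[ s ∈ allRows n ] cell (x ∷ r) (y ∷ s)
    ≡⟨ ∑-cong bools (λ x → ∑-cong bools (λ y → first-column n p q k x y)) ⟩
  ∑[ x ∈ bools ] ∑[ y ∈ bools ] contribution n p q k x y ∎
  where
  cell : Vec Bool (suc n) → Vec Bool (suc n) → ℕ
  cell r s = bit (gridAfter p q r s ∧ (countRow r + countRow s ℕ.≡ᵇ k))

-- A n k counts all independent k-sets of the 2×n grid, B n k those whose
-- top-left square is free (by symmetry, equally those with bottom-left free).
A B : ℕ → ℕ → ℕ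
A zero zero = 1
A zero (suc k) = 0
A (suc n) k = A n k + shift 1 (B n) k + shift 1 (B n) k
B zero k = A zero k
B (suc n) k = A n k + shift 1 (B n) k

count-A : ∀ n k → count n false false k ≡ A n k
count-B : ∀ n k → count n true false k ≡ B n k
count-B′ : ∀ n k → count n false true k ≡ B n k

count-A zero zero = refl
count-A zero (suc k) = refl
count-A (suc n) k = begin
  count (suc n) false false k
    ≡⟨ count-step n false false k ⟩
  (count n false false k + (shift 1 (count n false true) k + 0)) + ((shift 1 (count n true false) k + (0 + 0)) + 0)
    ≡⟨ cong₂ (λ a b → (count n false false k + (a + 0)) + ((b + (0 + 0)) + 0))
             (shift-cong 1 (count-B′ n) k) (shift-cong 1 (count-B n) k) ⟩
  (count n false false k + (shift 1 (B n) k + 0)) + ((shift 1 (B n) k + (0 + 0)) + 0)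
    ≡⟨ cong (λ a → (a + (shift 1 (B n) k + 0)) + ((shift 1 (B n) k + (0 + 0)) + 0)) (count-A n k) ⟩
  (A n k + (shift 1 (B n) k + 0)) + ((shift 1 (B n) k + (0 + 0)) + 0)
    ≡⟨ tidy (A n k) (shift 1 (B n) k) ⟩
  A (suc n) k ∎
  where
  tidy : ∀ a b → (a + (b + 0)) + ((b + (0 + 0)) + 0) ≡ a + b + b
  tidy = solve-∀

count-B zero zero = refl
count-B zero (suc k) = refl
count-B (suc n) k = begin
  count (suc n) true false k
    ≡⟨ count-step n true false k ⟩
  (count n false false k + (shift 1 (count n false true) k + 0)) + (0 + 0)
    ≡⟨ cong₂ (λ a b → (a + (b + 0)) + (0 + 0)) (count-A n k) (shift-cong 1 (count-B′ n) k) ⟩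
  (A n k + (shift 1 (B n) k + 0)) + (0 + 0)
    ≡⟨ tidy (A n k) (shift 1 (B n) k) ⟩
  B (suc n) k ∎
  where
  tidy : ∀ a b → (a + (b + 0)) + (0 + 0) ≡ a + b
  tidy = solve-∀

count-B′ zero zero = refl
count-B′ zero (suc k) = refl
count-B′ (suc n) k = begin
  count (suc n) false true k
    ≡⟨ count-step n false true k ⟩
  (count n false false k + (0 + 0)) + ((shift 1 (count n true false) k + (0 + 0)) + 0)
    ≡⟨ cong₂ (λ a b → (a + (0 + 0)) + ((b + (0 + 0)) + 0)) (count-A n k) (shift-cong 1 (count-B n) k) ⟩
  (A n k + (0 + 0)) + ((shift 1 (B n) k + (0 + 0)) + 0)
    ≡⟨ tidy (A n k) (shift 1 (B n) k) ⟩
  B (suc n) k ∎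
  where
  tidy : ∀ a b → (a + (0 + 0)) + ((b + (0 + 0)) + 0) ≡ a + b
  tidy = solve-∀

A-empty : ∀ n → A n 0 ≡ 1
A-empty zero = refl
A-empty (suc n) = trans (+-identityʳ _) (trans (+-identityʳ _) (A-empty n))

B-empty : ∀ n → B n 0 ≡ 1
B-empty zero = refl
B-empty (suc n) = trans (+-identityʳ _) (A-empty n)

A-vanish : ∀ {n m} → n < m → A n m ≡ 0
B-vanish : ∀ {n m} → n < m → B n m ≡ 0
A-vanish {zero} {suc m} _ = refl
A-vanish {suc n} {suc (suc m)} (s≤s (s≤s n≤m)) =
  cong₂ (λ a b → a + b + b) (A-vanish (s≤s (m≤n⇒m≤1+n n≤m))) (B-vanish (s≤s n≤m))
B-vanish {zero} {suc m} _ = refl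
B-vanish {suc n} {suc (suc m)} (s≤s (s≤s n≤m)) =
  cong₂ _+_ (A-vanish (s≤s (m≤n⇒m≤1+n n≤m))) (B-vanish (s≤s n≤m))

-- With the top-left square free, the only independent n-set of the 2×n grid
-- takes the squares of the other colour class of the chessboard colouring.
B-full : ∀ n → B n n ≡ 1
B-full zero = refl
B-full (suc n) = cong₂ _+_ (A-vanish (n<1+n n)) (B-full n)

-- B satisfies the Delannoy recurrence along the antidiagonals n = p + q.
B-recurrence : ∀ m k → B (suc (suc m)) (suc k) ≡ B (suc m) k + B (suc m) (suc k) + B m k
B-recurrence m k = rearrange (A m (suc k)) (B m k) (B (suc m) k)
  where
  rearrange : ∀ a b c → (a + b + b) + c ≡ c + (a + b) + b
  rearrange = solve-∀

-- D p q: the number of lattice paths from (0,0) to (p,q) with steps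
-- (1,0), (0,1) and (1,1).
D : ℕ → ℕ → ℕ
D zero q = 1
D (suc p) zero = 1
D (suc p) (suc q) = D p (suc q) + D (suc p) q + D p q

D-sym : ∀ p q → D p q ≡ D q p
D-sym zero zero = refl
D-sym zero (suc q) = refl
D-sym (suc p) zero = refl
D-sym (suc p) (suc q) rewrite D-sym p (suc q) | D-sym (suc p) q | D-sym p q =
  cong (_+ D q p) (+-comm (D (suc q) p) (D q (suc p)))

-- D⁻ p q = D(p-1, q+1), the preceding entry on the antidiagonal p + q
-- (and 0 for p = 0).
D⁻ : ℕ → ℕ → ℕ
D⁻ zero q = 0
D⁻ (suc p) q = D p (suc q)

-- The Delannoy recurrence read in the second index; with the convention of
-- D⁻ it also holds for p = 0.
D-recurrence₂ : ∀ p q → D p (suc (suc q)) ≡ D⁻ p (suc q) + D p (suc q) + D⁻ p q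
D-recurrence₂ zero q = refl
D-recurrence₂ (suc p) q = refl

D-antidiagonal : ∀ p q → p < q → D p (suc q) < D (suc p) q
D-antidiagonal zero (suc q) _ = s≤s (m≤n+m 1 (D 1 q))
D-antidiagonal (suc p) (suc q) (s≤s p<q) =
  +-mono-≤-< (≤-trans (+-monoˡ-≤ M outer) (≤-reflexive (+-comm (D (suc (suc p)) q) M)))
             (D-antidiagonal p q p<q)
  where
  M = D (suc p) (suc q)
  -- M sits between its two antidiagonal neighbours; the right-hand comparison
  -- is an equality by symmetry when M is the middle entry.
  middle : D (suc p) (suc q) ≤ D (suc (suc p)) q
  middle with m≤n⇒m<n∨m≡n p<q
  ... | inj₁ sp<q = <⇒≤ (D-antidiagonal (suc p) q sp<q)
  ... | inj₂ refl = ≤-reflexive (D-sym (suc p) (suc (suc p)))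
  outer : D p (suc (suc q)) ≤ D (suc (suc p)) q
  outer = ≤-trans (<⇒≤ (D-antidiagonal p (suc q) (m≤n⇒m≤1+n p<q))) middle

D⁻<D : ∀ p → D⁻ p p < D p p
D⁻<D zero = s≤s z≤n
D⁻<D (suc p) = D-antidiagonal p (suc p) (n<1+n p)

B-Delannoy : ∀ p q → B (p + q) p ≡ D p q
B-Delannoy zero q = B-empty q
B-Delannoy (suc p) zero = trans (cong (λ n → B n (suc p)) (+-identityʳ (suc p))) (B-full (suc p))
B-Delannoy (suc p) (suc q) = begin
  B (suc p + suc q) (suc p)
    ≡⟨ cong (λ n → B (suc n) (suc p)) (+-suc p q) ⟩
  B (suc (suc (p + q))) (suc p)
    ≡⟨ B-recurrence (p + q) p ⟩
  B (suc (p + q)) p + B (suc p + q) (suc p) + B (p + q) p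
    ≡⟨ cong (λ n → B n p + B (suc p + q) (suc p) + B (p + q) p) (sym (+-suc p q)) ⟩
  B (p + suc q) p + B (suc p + q) (suc p) + B (p + q) p
    ≡⟨ cong₂ (λ a b → a + b + B (p + q) p) (B-Delannoy p (suc q)) (B-Delannoy (suc p) q) ⟩
  D p (suc q) + D (suc p) q + B (p + q) p
    ≡⟨ cong (D p (suc q) + D (suc p) q +_) (B-Delannoy p q) ⟩
  D (suc p) (suc q) ∎

shift-B-Delannoy : ∀ p q → shift 1 (B (p + q)) p ≡ D⁻ p q
shift-B-Delannoy zero q = refl
shift-B-Delannoy (suc p) q = trans (cong (λ n → B n p) (sym (+-suc p q))) (B-Delannoy p (suc q))

T2-Delannoy : ∀ p q → T2 (p + q) p + D⁻ p q ≡ D p (suc q)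
T2-Delannoy p q = begin
  T2 (p + q) p + D⁻ p q
    ≡⟨ cong₂ _+_ (trans (T2-count (p + q) p) (count-A (p + q) p)) (sym (shift-B-Delannoy p q)) ⟩
  A (p + q) p + shift 1 (B (p + q)) p
    ≡⟨ cong (λ n → B n p) (sym (+-suc p q)) ⟩
  B (p + suc q) p
    ≡⟨ B-Delannoy p (suc q) ⟩
  D p (suc q) ∎

T2-lower : ∀ j → T2 (j + suc j) j ≡ D j (suc j) + D⁻ j j
T2-lower j = +-cancelʳ-≡ (D⁻ j (suc j)) _ _ (begin
  T2 (j + suc j) j + D⁻ j (suc j)          ≡⟨ T2-Delannoy j (suc j) ⟩
  D j (suc (suc j))                        ≡⟨ D-recurrence₂ j j ⟩
  D⁻ j (suc j) + D j (suc j) + D⁻ j j      ≡⟨ rotate (D⁻ j (suc j)) (D j (suc j)) (D⁻ j j) ⟩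
  D j (suc j) + D⁻ j j + D⁻ j (suc j)      ∎)
  where
  rotate : ∀ a b c → a + b + c ≡ b + c + a
  rotate = solve-∀

T2-upper : ∀ j → T2 (j + suc j) (suc j) ≡ D j (suc j) + D j j
T2-upper j = +-cancelʳ-≡ (D j (suc j)) _ _ (begin
  T2 (j + suc j) (suc j) + D j (suc j)     ≡⟨ cong (λ n → T2 n (suc j) + D j (suc j)) (+-suc j j) ⟩
  T2 (suc j + j) (suc j) + D⁻ (suc j) j    ≡⟨ T2-Delannoy (suc j) j ⟩
  D j (suc j) + D (suc j) j + D j j        ≡⟨ cong (λ d → D j (suc j) + d + D j j) (D-sym (suc j) j) ⟩
  D j (suc j) + D j (suc j) + D j j        ≡⟨ rotate (D j (suc j)) (D j j) ⟩
  D j (suc j) + D j j + D j (suc j)        ∎)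
  where
  rotate : ∀ a c → a + a + c ≡ a + c + a
  rotate = solve-∀


odd-width : ∀ j → 2 * suc j ∸ 1 ≡ j + suc j
odd-width j = cong (λ m → j + suc m) (+-identityʳ j)

corollary11 : ∀ (k : ℕ) → k ≥ 1 → T2 (2 * k ∸ 1) (k ∸ 1) < T2 (2 * k ∸ 1) k
corollary11 (suc j) _ = subst (λ n → T2 n j < T2 n (suc j)) (sym (odd-width j))
  (subst₂ _<_ (sym (T2-lower j)) (sym (T2-upper j)) (+-monoʳ-< (D j (suc j)) (D⁻<D j)))
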